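{- Let $T$ be a regular tournament of order $2n+1$. Let $S\subseteq V(T)$ and let $x,y$ be two distinct vertices in $V(T)\setminus S$. Then: (i) If $n\geq 3$ and $|S|\leq \frac{1}{3}(n-1)$, then $T-S$ contains an $(x,y)$-path of length 3, unless $T$ is isomorphic to a tournament from $\mathcal{G}$. (ii) If $n\geq 5$, $|S|\leq \frac{1}{2}n$, and $T-S$ contains no $(x,y)$-path of length 3, then $T-S$ contains an $(x,y)$-path of length 4.
   Context: A tournament is an oriented graph in which every pair of distinct vertices is joined by exactly one arc; it is regular if every vertex has equal outdegree and indegree. $T-S$ is the subtournament induced by $V(T)\setminus S$. Paths are directed and simple; length is the number of arcs. For vertex sets $X,Y$, $X\rightarrow Y$ means every vertex of $X$ has an arc to every vertex of $Y$; a single vertex $v$ is identified with $\{v\}$. The family $\mathcal{G}$ is the set of regular tournaments of order $6k+3\geq 9$ whose vertex set is $\{x,y,z\}\cup A\cup B\cup C\cup S$ (disjoint union) with $|A|=|C|=2k-1$, $|B|=k+2$, $|S|=k$, such that the subtournaments induced by $A$, by $C$ and by $\{z\}\cup B\cup S$ are regular, and $A\rightarrow B\cup S\rightarrow C$, $C\rightarrow A$, $C\rightarrow z\rightarrow A$, $x\rightarrow \{y,z\}\cup A\cup S$, $\{x,z\}\cup C\cup S\rightarrow y$, $y\rightarrow A\cup B$, and $B\cup C\rightarrow x$. -}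

module Defs where

open import Data.Nat using (ℕ; zero; suc; _+_; _*_; _≥_; _∸_)
open import Data.Bool using (Bool; true; false; not; if_then_else_; _∧_)
open import Data.Fin using (Fin)
import Data.Fin as F
open import Data.Fin.Subset using (Subset; _∈_; _∉_; _∪_; ∣_∣; ⁅_⁆)
open import Data.Vec using (lookup)
open import Data.Product using (Σ; ∃; _×_; ∃-syntax)
open import Data.Sum using (_⊎_)
open import Relation.Binary.PropositionalEquality using (_≡_; _≢_)
open import Function.Bundles using (_↔_; Inverse)

count : {m : ℕ} → (Fin m → Bool) → ℕ
count {zero}  f = 0
count {suc m} f = (if f F.zero then 1 else 0) + count (λ i → f (F.suc i))

-- A tournament on vertex set Fin m: arc u v ≡ true means u → v.
record Tournament (m : ℕ) : Set where
  field
    arc    : Fin m → Fin m → Bool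
    irrefl : ∀ u → arc u u ≡ false
    tourn  : ∀ u v → u ≢ v → arc u v ≡ not (arc v u)
open Tournament public

outdegIn : {m : ℕ} → Tournament m → Subset m → Fin m → ℕ
outdegIn T X u = count (λ v → lookup X v ∧ arc T u v)

indegIn : {m : ℕ} → Tournament m → Subset m → Fin m → ℕ
indegIn T X u = count (λ v → lookup X v ∧ arc T v u)

outdeg : {m : ℕ} → Tournament m → Fin m → ℕ
outdeg T u = count (λ v → arc T u v)

indeg : {m : ℕ} → Tournament m → Fin m → ℕ
indeg T u = count (λ v → arc T v u)

Regular : {m : ℕ} → Tournament m → Set
Regular T = ∀ u → outdeg T u ≡ indeg T u

RegularOn : {m : ℕ} → Tournament m → Subset m → Set
RegularOn T X = ∀ u → u ∈ X → outdegIn T X u ≡ indegIn T X u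

_⟶_ : {m : ℕ} → Tournament m → Fin m → Fin m → Set
(T ⟶ u) v = arc T u v ≡ true

Dominates : {m : ℕ} → Tournament m → Subset m → Subset m → Set
Dominates T X Y = ∀ u v → u ∈ X → v ∈ Y → (T ⟶ u) v

VDom : {m : ℕ} → Tournament m → Fin m → Subset m → Set
VDom T u Y = ∀ v → v ∈ Y → (T ⟶ u) v

DomV : {m : ℕ} → Tournament m → Subset m → Fin m → Set
DomV T X v = ∀ u → u ∈ X → (T ⟶ u) v

Path3 : {m : ℕ} → Tournament m → Subset m → Fin m → Fin m → Set
Path3 T S x y = Σ (Fin _) λ a → Σ (Fin _) λ b →
  (a ∉ S) × (b ∉ S) ×
  (x ≢ a) × (x ≢ b) × (x ≢ y) × (a ≢ b) × (a ≢ y) × (b ≢ y) ×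
  (T ⟶ x) a × (T ⟶ a) b × (T ⟶ b) y

Path4 : {m : ℕ} → Tournament m → Subset m → Fin m → Fin m → Set
Path4 T S x y = Σ (Fin _) λ a → Σ (Fin _) λ b → Σ (Fin _) λ c →
  (a ∉ S) × (b ∉ S) × (c ∉ S) ×
  (x ≢ a) × (x ≢ b) × (x ≢ c) × (x ≢ y) ×
  (a ≢ b) × (a ≢ c) × (a ≢ y) × (b ≢ c) × (b ≢ y) × (c ≢ y) ×
  (T ⟶ x) a × (T ⟶ a) b × (T ⟶ b) c × (T ⟶ c) y

Iso : {m m' : ℕ} → Tournament m → Tournament m' → Set
Iso {m} {m'} T T' = Σ (Fin m ↔ Fin m') λ f →
  ∀ u v → arc T' (Inverse.to f u) (Inverse.to f v) ≡ arc T u v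

record InG {m : ℕ} (T : Tournament m) : Set where
  field
    k : ℕ
    k≥1 : k ≥ 1
    order : m ≡ 6 * k + 3
    regular : Regular T
    x y z : Fin m
    A B C S : Subset m
    x≢y : x ≢ y
    x≢z : x ≢ z
    y≢z : y ≢ z
    x∉ : x ∉ A × x ∉ B × x ∉ C × x ∉ S
    y∉ : y ∉ A × y ∉ B × y ∉ C × y ∉ S
    z∉ : z ∉ A × z ∉ B × z ∉ C × z ∉ S
    A∩B : ∀ v → v ∈ A → v ∉ B
    A∩C : ∀ v → v ∈ A → v ∉ C
    A∩S : ∀ v → v ∈ A → v ∉ S
    B∩C : ∀ v → v ∈ B → v ∉ C
    B∩S : ∀ v → v ∈ B → v ∉ S
    C∩S : ∀ v → v ∈ C → v ∉ S
    cover : ∀ v → (v ≡ x) ⊎ (v ≡ y) ⊎ (v ≡ z) ⊎ (v ∈ A) ⊎ (v ∈ B) ⊎ (v ∈ C) ⊎ (v ∈ S)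
    |A| : ∣ A ∣ ≡ 2 * k ∸ 1
    |C| : ∣ C ∣ ≡ 2 * k ∸ 1
    |B| : ∣ B ∣ ≡ k + 2
    |S| : ∣ S ∣ ≡ k
    regA : RegularOn T A
    regC : RegularOn T C
    regzBS : RegularOn T (⁅ z ⁆ ∪ B ∪ S)
    A→B∪S : Dominates T A (B ∪ S)
    B∪S→C : Dominates T (B ∪ S) C
    C→A : Dominates T C A
    C→z : DomV T C z
    z→A : VDom T z A
    x→y : (T ⟶ x) y
    x→z : (T ⟶ x) z
    x→A∪S : VDom T x (A ∪ S)
    z→y : (T ⟶ z) y
    C∪S→y : DomV T (C ∪ S) y
    y→A∪B : VDom T y (A ∪ B)
    B∪C→x : DomV T (B ∪ C) x

module Submission where

-- Suppose T − S has no (x,y)-path of length 3. Every other vertex v ∉ S is classified by its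
-- arcs with x and y: A (x → v, y → v), B (v → x, y → v), C (v → x, v → y), Z (x → v → y).
-- No out-neighbour of x dominates an in-neighbour of y, so |Z| ≤ 1 and the out-neighbours of a
-- vertex of A lie in S ∪ A ∪ B. Summing degrees inside A yields a ∈ A with d⁺_A(a) ≤ d⁻_A(a),
-- hence with many out-neighbours in B; reversing all arcs and swapping x and y yields c ∈ C with
-- many in-neighbours in B. Compared with the degrees of x and y these bounds leave no room: in
-- (ii) the two neighbourhoods are disjoint in B (a common vertex b gives the path x a b c y),
-- which is impossible once 2|S| ≤ n; in (i) every inequality must be an equality, which forces
-- each vertex of A and C to be joined to all of S ∪ B, and A, C and {z} ∪ B ∪ S to be regular.

open import Defs
open import Data.Nat using (ℕ; suc; _+_; _*_; _≤_; _≥_; _∸_)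
open import Data.Fin using (Fin)
open import Data.Fin.Subset using (Subset; _∉_; ∣_∣)
open import Data.Product using (Σ; _×_)
open import Data.Sum using (_⊎_)
open import Relation.Binary.PropositionalEquality using (_≢_)
open import Relation.Nullary using (¬_)

open import Data.Nat using (zero; z≤n; s≤s; _<_)
open import Data.Nat.Properties hiding (_≟_)
open import Data.Nat.Tactic.RingSolver using (solve-∀)
open import Algebra.Properties.CommutativeMonoid.Sum +-0-commutativeMonoid
  using (sum; sum-cong-≗; ∑-distrib-+; ∑-comm)
open import Data.Bool using (Bool; true; false; not; if_then_else_; _∧_; _∨_)
open import Data.Bool.Properties using (∧-identityʳ; ∧-zeroʳ; ⇔→≡)
import Data.Bool.Properties as Bool
open import Data.Empty using (⊥; ⊥-elim)
open import Data.Fin using (zero; suc; _≟_)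
open import Data.Fin.Properties using (any?)
import Data.Fin.Properties as Fin
open import Data.Fin.Subset using (_∈_; ⁅_⁆; _∪_)
open import Data.Fin.Subset.Properties using (_∈?_; x∈p∪q⁻; x∈p∪q⁺; x∈⁅x⁆; x∈⁅y⁆⇒x≡y)
open import Data.Product using (∃; _,_; proj₁; proj₂)
open import Data.Sum using (inj₁; inj₂)
import Data.Sum as Sum
open import Data.Vec using (lookup; tabulate)
import Data.Vec as Vec
open import Data.Vec.Properties using ([]=⇒lookup; lookup⇒[]=; lookup∘tabulate; tabulate-cong)
open import Function using (_∘_)
open import Function.Bundles using (mk⇔)
open import Function.Construct.Identity using (↔-id)
open import Relation.Binary using (tri<; tri≈; tri>)
open import Relation.Binary.PropositionalEquality
  using (_≡_; refl; sym; trans; cong; cong₂; subst; subst₂; module ≡-Reasoning)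
open import Relation.Nullary using (Dec; yes; no; does; contradiction)
open import Relation.Nullary.Decidable using (dec-true; dec-false; _×-dec_; ¬?; decidable-stable)

-- Counting

toℕ : Bool → ℕ
toℕ b = if b then 1 else 0

toℕ≤1 : ∀ b → toℕ b ≤ 1
toℕ≤1 false = z≤n
toℕ≤1 true  = ≤-refl

toℕ≡1 : ∀ {b} → toℕ b ≡ 1 → b ≡ true
toℕ≡1 {true} _ = refl

countIn : {m : ℕ} → Subset m → (Fin m → Bool) → ℕ
countIn X g = count (λ v → lookup X v ∧ g v)

count≡sum : ∀ {m} (f : Fin m → Bool) → count f ≡ sum (toℕ ∘ f)
count≡sum {zero}  f = refl
count≡sum {suc m} f = cong (toℕ (f zero) +_) (count≡sum (f ∘ suc))

count-cong : ∀ {m} {f g : Fin m → Bool} → (∀ v → f v ≡ g v) → count f ≡ count g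
count-cong {zero}  _   = refl
count-cong {suc m} f≗g = cong₂ _+_ (cong toℕ (f≗g zero)) (count-cong (f≗g ∘ suc))

count-+ : ∀ {m} {f g h : Fin m → Bool} →
  (∀ v → toℕ (f v) + toℕ (g v) ≡ toℕ (h v)) → count f + count g ≡ count h
count-+ {f = f} {g} {h} pointwise = begin
  count f + count g                  ≡⟨ cong₂ _+_ (count≡sum f) (count≡sum g) ⟩
  sum (toℕ ∘ f) + sum (toℕ ∘ g)      ≡⟨ ∑-distrib-+ (toℕ ∘ f) (toℕ ∘ g) ⟨
  sum (λ v → toℕ (f v) + toℕ (g v))  ≡⟨ sum-cong-≗ pointwise ⟩
  sum (toℕ ∘ h)                      ≡⟨ count≡sum h ⟨
  count h                            ∎
  where open ≡-Reasoning

sum-mono-≤ : ∀ {m} {u w : Fin m → ℕ} → (∀ i → u i ≤ w i) → sum u ≤ sum w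
sum-mono-≤ {zero}  _   = z≤n
sum-mono-≤ {suc m} u≤w = +-mono-≤ (u≤w zero) (sum-mono-≤ (u≤w ∘ suc))

sum-mono-< : ∀ {m} {u w : Fin m → ℕ} → (∀ i → u i ≤ w i) → ∀ j → u j < w j → sum u < sum w
sum-mono-< {suc m} u≤w zero    uj<wj = +-mono-<-≤ uj<wj (sum-mono-≤ (u≤w ∘ suc))
sum-mono-< {suc m} u≤w (suc j) uj<wj = +-mono-≤-< (u≤w zero) (sum-mono-< (u≤w ∘ suc) j uj<wj)

sum-mono-tight : ∀ {m} {u w : Fin m → ℕ} → (∀ i → u i ≤ w i) → sum w ≤ sum u → ∀ i → u i ≡ w i
sum-mono-tight {u = u} {w} u≤w ∑w≤∑u i with <-cmp (u i) (w i)
... | tri< ui<wi _ _ = ⊥-elim (<⇒≱ (sum-mono-< u≤w i ui<wi) ∑w≤∑u)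
... | tri≈ _ ui≡wi _ = ui≡wi
... | tri> _ _ ui>wi = ⊥-elim (<⇒≱ ui>wi (u≤w i))

toℕ-mono : ∀ {a b} → (a ≡ true → b ≡ true) → toℕ a ≤ toℕ b
toℕ-mono {false} _   = z≤n
toℕ-mono {true}  a⇒b rewrite a⇒b refl = ≤-refl

count-mono : ∀ {m} {f g : Fin m → Bool} → (∀ v → f v ≡ true → g v ≡ true) → count f ≤ count g
count-mono {f = f} {g} f⊆g =
  subst₂ _≤_ (sym (count≡sum f)) (sym (count≡sum g)) (sum-mono-≤ (toℕ-mono ∘ f⊆g))

count-mono-tight : ∀ {m} {f g : Fin m → Bool} → (∀ v → f v ≡ true → g v ≡ true) →
  count g ≤ count f → ∀ v → g v ≡ true → f v ≡ true
count-mono-tight {f = f} {g} f⊆g #g≤#f v gv with f v in fv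
... | true  = refl
... | false = ⊥-elim (0≢1+n (subst₂ _≡_ (cong toℕ fv) (cong toℕ gv) toℕ-fv≡toℕ-gv))
  where
  toℕ-fv≡toℕ-gv : toℕ (f v) ≡ toℕ (g v)
  toℕ-fv≡toℕ-gv = sum-mono-tight (toℕ-mono ∘ f⊆g)
    (subst₂ _≤_ (count≡sum g) (count≡sum f) #g≤#f) v

count-+-≤ : ∀ {m} {f g h : Fin m → Bool} →
  (∀ v → toℕ (f v) + toℕ (g v) ≤ toℕ (h v)) → count f + count g ≤ count h
count-+-≤ {f = f} {g} {h} pointwise = begin
  count f + count g                  ≡⟨ cong₂ _+_ (count≡sum f) (count≡sum g) ⟩
  sum (toℕ ∘ f) + sum (toℕ ∘ g)      ≡⟨ ∑-distrib-+ (toℕ ∘ f) (toℕ ∘ g) ⟨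
  sum (λ v → toℕ (f v) + toℕ (g v))  ≤⟨ sum-mono-≤ pointwise ⟩
  sum (toℕ ∘ h)                      ≡⟨ count≡sum h ⟨
  count h                            ∎
  where open ≤-Reasoning

count-false : ∀ {m} {f : Fin m → Bool} → (∀ v → f v ≡ false) → count f ≡ 0
count-false {zero}  _ = refl
count-false {suc m} {f} f≗false rewrite f≗false zero = count-false (f≗false ∘ suc)

count-true : ∀ m → count {m} (λ _ → true) ≡ m
count-true zero    = refl
count-true (suc m) = cong suc (count-true m)

count-witness : ∀ {m} {f : Fin m → Bool} → 1 ≤ count f → ∃ λ v → f v ≡ true
count-witness {suc m} {f} #f≥1 with f zero in f0
... | true  = zero , f0
... | false = let (v , fv) = count-witness {f = f ∘ suc} #f≥1 in suc v , fv

count-≤1 : ∀ {m} {f : Fin m → Bool} → (∀ u v → f u ≡ true → f v ≡ true → u ≡ v) → count f ≤ 1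
count-≤1 {zero}  _      = z≤n
count-≤1 {suc m} {f} unique with f zero in f0
... | true  = ≤-reflexive (cong suc (count-false rest-false))
  where
  rest-false : ∀ i → f (suc i) ≡ false
  rest-false i with f (suc i) in fi
  ... | true  with () ← unique zero (suc i) f0 fi
  ... | false = refl
... | false = count-≤1 λ u v fu fv → Fin.suc-injective (unique (suc u) (suc v) fu fv)

count-single : ∀ {m} (u : Fin m) (g : Fin m → Bool) → count (λ v → does (u ≟ v) ∧ g v) ≡ toℕ (g u)
count-single {suc m} zero    g =
  trans (cong (toℕ (g zero) +_) (count-false {m} λ _ → refl)) (+-identityʳ _)
count-single {suc m} (suc u) g = count-single u (g ∘ suc)

∣∣≡count : ∀ {m} (X : Subset m) → ∣ X ∣ ≡ count (lookup X)
∣∣≡count Vec.[]           = refl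
∣∣≡count (true Vec.∷ X)  = cong suc (∣∣≡count X)
∣∣≡count (false Vec.∷ X) = ∣∣≡count X

∈⇒lookup : ∀ {m} {X : Subset m} {v} → v ∈ X → lookup X v ≡ true
∈⇒lookup = []=⇒lookup

lookup⇒∈ : ∀ {m} {X : Subset m} {v} → lookup X v ≡ true → v ∈ X
lookup⇒∈ {X = X} {v} = lookup⇒[]= v X

∈-tabulate : ∀ {m} {f : Fin m → Bool} {v} → v ∈ tabulate f → f v ≡ true
∈-tabulate {f = f} {v} v∈ = trans (sym (lookup∘tabulate f v)) (∈⇒lookup v∈)

∉⇒lookup : ∀ {m} {X : Subset m} {v} → v ∉ X → lookup X v ≡ false
∉⇒lookup {X = X} {v} v∉X with lookup X v in Xv
... | true  = ⊥-elim (v∉X (lookup⇒∈ Xv))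
... | false = refl

tabulate-∈ : ∀ {m} {f : Fin m → Bool} {v} → f v ≡ true → v ∈ tabulate f
tabulate-∈ {f = f} {v} fv = lookup⇒∈ (trans (lookup∘tabulate f v) fv)

countIn-true : ∀ {m} (X : Subset m) → countIn X (λ _ → true) ≡ ∣ X ∣
countIn-true X = trans (count-cong λ v → ∧-identityʳ (lookup X v)) (sym (∣∣≡count X))

module _ {m : ℕ} {X : Subset m} where

  countIn-cong : {g h : Fin m → Bool} → (∀ v → v ∈ X → g v ≡ h v) → countIn X g ≡ countIn X h
  countIn-cong {g} {h} g≗h = count-cong pointwise
    where
    pointwise : ∀ v → (lookup X v ∧ g v) ≡ (lookup X v ∧ h v)
    pointwise v with lookup X v in Xv
    ... | true  = g≗h v (lookup⇒∈ Xv)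
    ... | false = refl

  countIn-mono : {g h : Fin m → Bool} → (∀ v → v ∈ X → g v ≡ true → h v ≡ true) →
    countIn X g ≤ countIn X h
  countIn-mono {g} {h} g⊆h = count-mono pointwise
    where
    pointwise : ∀ v → (lookup X v ∧ g v) ≡ true → (lookup X v ∧ h v) ≡ true
    pointwise v with lookup X v in Xv
    ... | true  = g⊆h v (lookup⇒∈ Xv)
    ... | false = λ ()

  countIn-false : {g : Fin m → Bool} → (∀ v → v ∈ X → g v ≡ false) → countIn X g ≡ 0
  countIn-false g≗false = trans (countIn-cong g≗false) (count-false λ v → ∧-zeroʳ (lookup X v))

  countIn-all : {g : Fin m → Bool} → (∀ v → v ∈ X → g v ≡ true) → countIn X g ≡ ∣ X ∣
  countIn-all all = trans (countIn-cong all) (countIn-true X)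

  countIn-full : {g : Fin m → Bool} → ∣ X ∣ ≤ countIn X g → ∀ v → v ∈ X → g v ≡ true
  countIn-full {g} ∣X∣≤ v v∈X = subst (λ b → (b ∧ g v) ≡ true) (∈⇒lookup v∈X) X∧gv
    where
    X∧g⊆X∧true : ∀ u → (lookup X u ∧ g u) ≡ true → (lookup X u ∧ true) ≡ true
    X∧g⊆X∧true u with lookup X u
    ... | true  = λ _ → refl
    ... | false = λ ()
    X∧gv : (lookup X v ∧ g v) ≡ true
    X∧gv = count-mono-tight X∧g⊆X∧true (subst (_≤ countIn X g) (sym (countIn-true X)) ∣X∣≤) v
             (trans (∧-identityʳ _) (∈⇒lookup v∈X))

  countIn-inside : ∀ {Y : Subset m} {g : Fin m → Bool} → (∀ v → v ∈ X → v ∈ Y) →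
    countIn X (λ v → lookup Y v ∧ g v) ≡ countIn X g
  countIn-inside {g = g} X⊆Y = countIn-cong λ v v∈X → cong (_∧ g v) (∈⇒lookup (X⊆Y v v∈X))

  countIn-outside : ∀ {Y : Subset m} {g : Fin m → Bool} → (∀ v → v ∈ X → v ∉ Y) →
    countIn X (λ v → lookup Y v ∧ g v) ≡ 0
  countIn-outside {g = g} X∩Y=∅ = countIn-false λ v v∈X → cong (_∧ g v) (∉⇒lookup (X∩Y=∅ v v∈X))

countIn-≤ : ∀ {m} (X : Subset m) (g : Fin m → Bool) → countIn X g ≤ ∣ X ∣
countIn-≤ X g = subst (countIn X g ≤_) (countIn-true X) (countIn-mono {X = X} λ _ _ _ → refl)

part : ∀ {m K} → (Fin m → Fin K) → Fin K → Subset m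
part kind k = tabulate (λ v → does (kind v ≟ k))

module _ {m K : ℕ} (kind : Fin m → Fin K) where

  ∈-part : ∀ {k v} → v ∈ part kind k → kind v ≡ k
  ∈-part {k} {v} v∈ with kind v ≟ k | ∈-tabulate {f = λ u → does (kind u ≟ k)} v∈
  ... | yes kv≡k | _ = kv≡k

  part-∈ : ∀ {k v} → kind v ≡ k → v ∈ part kind k
  part-∈ {k} {v} kv≡k = tabulate-∈ (dec-true (kind v ≟ k) kv≡k)

  count-partition : (g : Fin m → Bool) → count g ≡ sum (λ k → countIn (part kind k) g)
  count-partition g = begin
    count g                                                ≡⟨ count≡sum g ⟩
    sum (λ v → toℕ (g v))                                  ≡⟨ sum-cong-≗ split ⟩
    sum (λ v → sum (λ k → toℕ (does (kind v ≟ k) ∧ g v)))  ≡⟨ ∑-comm (λ v k → toℕ (does (kind v ≟ k) ∧ g v)) ⟩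
    sum (λ k → sum (λ v → toℕ (does (kind v ≟ k) ∧ g v)))  ≡⟨ sum-cong-≗ (sym ∘ countIn-part) ⟩
    sum (λ k → countIn (part kind k) g)                    ∎
    where
    open ≡-Reasoning
    split : ∀ v → toℕ (g v) ≡ sum (λ k → toℕ (does (kind v ≟ k) ∧ g v))
    split v = trans (sym (count-single (kind v) (λ _ → g v))) (count≡sum (λ k → does (kind v ≟ k) ∧ g v))
    countIn-part : ∀ k → countIn (part kind k) g ≡ sum (λ v → toℕ (does (kind v ≟ k) ∧ g v))
    countIn-part k = trans (count-cong λ v → cong (_∧ g v) (lookup∘tabulate (λ u → does (kind u ≟ k)) v))
                       (count≡sum (λ v → does (kind v ≟ k) ∧ g v))

-- Degrees in tournaments

reverse : ∀ {m} → Tournament m → Tournament m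
reverse T = record
  { arc    = λ u v → arc T v u
  ; irrefl = irrefl T
  ; tourn  = λ u v u≢v → tourn T v u (u≢v ∘ sym)
  }

reverse-regular : ∀ {m} (T : Tournament m) → Regular T → Regular (reverse T)
reverse-regular T reg = sym ∘ reg

restrict : ∀ {m} → Subset m → (Fin m → ℕ) → Fin m → ℕ
restrict X f u = if lookup X u then f u else 0

module _ {m : ℕ} (T : Tournament m) where

  arc-asym : ∀ {u v} → (T ⟶ u) v → arc T v u ≡ false
  arc-asym {u} {v} u→v with u ≟ v
  ... | yes refl = contradiction (trans (sym u→v) (irrefl T u)) λ ()
  ... | no u≢v   = trans (tourn T v u (u≢v ∘ sym)) (cong not u→v)

  ¬arc⇒arc : ∀ {u v} → u ≢ v → arc T u v ≡ false → (T ⟶ v) u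
  ¬arc⇒arc {u} {v} u≢v u↛v = trans (tourn T v u (u≢v ∘ sym)) (cong not u↛v)

  arc-∨ : ∀ u v → (arc T u v ∨ arc T v u) ≡ not (does (u ≟ v))
  arc-∨ u v with u ≟ v
  ... | yes refl rewrite irrefl T u = refl
  ... | no u≢v rewrite tourn T u v u≢v with arc T v u
  ...   | true  = refl
  ...   | false = refl

  degree-split : (P : Fin m → Bool) (u : Fin m) →
    count (λ v → P v ∧ arc T u v) + count (λ v → P v ∧ arc T v u) + toℕ (P u) ≡ count P
  degree-split P u = begin
    count (λ v → P v ∧ arc T u v) + count (λ v → P v ∧ arc T v u) + toℕ (P u)
      ≡⟨ cong₂ _+_ (count-+ out-or-in) (sym (count-single u P)) ⟩
    count (λ v → P v ∧ not (does (u ≟ v))) + count (λ v → does (u ≟ v) ∧ P v)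
      ≡⟨ count-+ other-or-self ⟩
    count P ∎
    where
    open ≡-Reasoning
    out-or-in : ∀ v → toℕ (P v ∧ arc T u v) + toℕ (P v ∧ arc T v u) ≡ toℕ (P v ∧ not (does (u ≟ v)))
    out-or-in v with P v
    ... | false = refl
    ... | true rewrite sym (arc-∨ u v) with arc T u v in u→v
    ...   | false = refl
    ...   | true rewrite arc-asym u→v = refl
    other-or-self : ∀ v → toℕ (P v ∧ not (does (u ≟ v))) + toℕ (does (u ≟ v) ∧ P v) ≡ toℕ (P v)
    other-or-self v with P v | does (u ≟ v)
    ... | true  | true  = refl
    ... | true  | false = refl
    ... | false | true  = refl
    ... | false | false = refl

  outdeg+indeg : ∀ u → outdeg T u + indeg T u + 1 ≡ m
  outdeg+indeg u = trans (degree-split (λ _ → true) u) (count-true m)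

  outdegIn+indegIn : ∀ {X u} → u ∈ X → outdegIn T X u + indegIn T X u + 1 ≡ ∣ X ∣
  outdegIn+indegIn {X} {u} u∈X =
    trans (subst (λ b → outdegIn T X u + indegIn T X u + toℕ b ≡ count (lookup X)) (∈⇒lookup u∈X)
                 (degree-split (lookup X) u))
          (sym (∣∣≡count X))

  handshake : (X : Subset m) → sum (restrict X (outdegIn T X)) ≡ sum (restrict X (indegIn T X))
  handshake X = begin
    sum (restrict X (outdegIn T X))                    ≡⟨ sum-cong-≗ out-as-sum ⟩
    sum (λ u → sum (λ v → toℕ (arcIn u v)))            ≡⟨ ∑-comm (λ u v → toℕ (arcIn u v)) ⟩
    sum (λ v → sum (λ u → toℕ (arcIn u v)))            ≡⟨ sum-cong-≗ in-as-sum ⟨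
    sum (restrict X (indegIn T X))                     ∎
    where
    open ≡-Reasoning
    arcIn : Fin m → Fin m → Bool
    arcIn u v = (lookup X u ∧ lookup X v) ∧ arc T u v
    out-as-sum : ∀ u → restrict X (outdegIn T X) u ≡ sum (λ v → toℕ (arcIn u v))
    out-as-sum u = trans (out-as-count u) (count≡sum (arcIn u))
      where
      out-as-count : ∀ u → restrict X (outdegIn T X) u ≡ count (arcIn u)
      out-as-count u with lookup X u
      ... | true  = refl
      ... | false = sym (count-false {m} λ _ → refl)
    in-as-sum : ∀ v → restrict X (indegIn T X) v ≡ sum (λ u → toℕ (arcIn u v))
    in-as-sum v = trans (in-as-count v) (count≡sum (λ u → arcIn u v))
      where
      in-as-count : ∀ v → restrict X (indegIn T X) v ≡ count (λ u → arcIn u v)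
      in-as-count v with lookup X v
      ... | true  = count-cong λ u → cong (_∧ arc T u v) (sym (∧-identityʳ (lookup X u)))
      ... | false = sym (count-false λ u → cong (_∧ arc T u v) (∧-zeroʳ (lookup X u)))

  ∃-outdegIn≤indegIn : {X : Subset m} → 1 ≤ ∣ X ∣ →
    ∃ λ u → u ∈ X × outdegIn T X u ≤ indegIn T X u
  ∃-outdegIn≤indegIn {X} ∣X∣≥1 with any? (λ u → u ∈? X ×-dec outdegIn T X u ≤? indegIn T X u)
  ... | yes found = found
  ... | no none   = ⊥-elim (<⇒≢ (sum-mono-< in≤out u₀ in<out) (sym (handshake X)))
    where
    in≤out : ∀ u → restrict X (indegIn T X) u ≤ restrict X (outdegIn T X) u
    in≤out u with lookup X u in Xu
    ... | true  = ≰⇒≥ λ out≤in → none (u , lookup⇒∈ Xu , out≤in)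
    ... | false = ≤-refl
    witness = count-witness (subst (1 ≤_) (∣∣≡count X) ∣X∣≥1)
    u₀ = proj₁ witness
    in<out : restrict X (indegIn T X) u₀ < restrict X (outdegIn T X) u₀
    in<out with lookup X u₀ | proj₂ witness
    ... | true | _ = ≰⇒> λ out≤in → none (u₀ , lookup⇒∈ (proj₂ witness) , out≤in)

  indegIn≤outdegIn⇒regularOn : {X : Subset m} →
    (∀ u → u ∈ X → indegIn T X u ≤ outdegIn T X u) → RegularOn T X
  indegIn≤outdegIn⇒regularOn {X} in≤out u u∈X =
    subst (λ b → (if b then outdegIn T X u else 0) ≡ (if b then indegIn T X u else 0)) (∈⇒lookup u∈X)
      (sym (sum-mono-tight restricted (≤-reflexive (handshake X)) u))
    where
    restricted : ∀ v → restrict X (indegIn T X) v ≤ restrict X (outdegIn T X) v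
    restricted v with lookup X v in Xv
    ... | true  = in≤out v (lookup⇒∈ Xv)
    ... | false = ≤-refl

regular⇒outdeg≡n : ∀ {n} (T : Tournament (2 * n + 1)) → Regular T → ∀ u → outdeg T u ≡ n
regular⇒outdeg≡n {n} T reg u = *-cancelˡ-≡ (outdeg T u) n 2 (+-cancelʳ-≡ 1 _ _ (begin
  2 * outdeg T u + 1               ≡⟨ cong (λ i → outdeg T u + (i + 0) + 1) (reg u) ⟩
  outdeg T u + (indeg T u + 0) + 1 ≡⟨ cong (λ i → outdeg T u + i + 1) (+-identityʳ (indeg T u)) ⟩
  outdeg T u + indeg T u + 1       ≡⟨ outdeg+indeg T u ⟩
  2 * n + 1                        ∎))
  where open ≡-Reasoning

regular⇒indeg≡n : ∀ {n} (T : Tournament (2 * n + 1)) → Regular T → ∀ u → indeg T u ≡ n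
regular⇒indeg≡n T reg u = trans (sym (reg u)) (regular⇒outdeg≡n T reg u)

-- Linear arithmetic of the degree counts

module Arithmetic where

  open import Data.List using (_∷_; [])
  open import Data.Nat.Tactic.RingSolver using (solve)

  infixr 5 _⊕_
  _⊕_ : ∀ {a b c d} → a ≤ b → c ≤ d → a + c ≤ b + d
  _⊕_ = +-mono-≤

  infixr 6 _⊗_
  _⊗_ : ∀ {a b} k → a ≤ b → k * a ≤ k * b
  k ⊗ a≤b = *-monoʳ-≤ k a≤b

  ≤e : ∀ {a b} → a ≡ b → a ≤ b
  ≤e = ≤-reflexive

  ≥e : ∀ {a b} → a ≡ b → b ≤ a
  ≥e = ≤-reflexive ∘ sym

  -- A linear certificate: a sum of hypotheses whose left side exceeds its right side by a
  -- positive constant, the identity being checked by the ring solver.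
  infeasible : ∀ {L R} k → L ≤ R → L ≡ suc k + R → ⊥
  infeasible {L} {R} k L≤R L≡ = <⇒≱ (subst (R <_) (sym L≡) (s≤s (m≤n+m R k))) L≤R

  -- ≮⇒≥ with its premise spelt out, so that a refuted hypothesis has a known type before the
  -- solver inspects the certificate built from it.
  ≤-by-contradiction : ∀ {a b} → (suc b ≤ a → ⊥) → a ≤ b
  ≤-by-contradiction = ≮⇒≥

  private variable
    n s a b c e δ σx σy βA βC σ d⁺ d⁻ β : ℕ

  -- s, a, b, c, e are |S|, |A|, |B|, |C|, |Z|; δ = 1 iff x → y; σx = |N⁺(x) ∩ S|, σy = |N⁻(y) ∩ S|.
  record Census (n s a b c e δ σx σy : ℕ) : Set where
    field
      order    : 2 * n + 1 ≡ 1 + (1 + (s + (a + (e + (c + b)))))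
      outdeg-x : n ≡ δ + (σx + (a + e))
      indeg-y  : n ≡ δ + (σy + (c + e))
      δ≤1      : δ ≤ 1
      e≤1      : e ≤ 1
      σx≤s     : σx ≤ s
      σy≤s     : σy ≤ s

  nonempty : n ≡ δ + (σ + (a + e)) → δ ≤ 1 → σ ≤ s → e ≤ 1 → s + 3 ≤ n → 1 ≤ a
  nonempty {a = suc a} _ _ _ _ _ = s≤s z≤n
  nonempty {n} {δ} {σ} {zero} {e} {s} n≡ δ≤1 σ≤s e≤1 s+3≤n =
    ⊥-elim (infeasible 0 (≤e n≡ ⊕ δ≤1 ⊕ σ≤s ⊕ e≤1 ⊕ s+3≤n) (solve (n ∷ s ∷ e ∷ δ ∷ σ ∷ [])))

  many-arcs-to-B : n ≡ σ + (d⁺ + β) → d⁺ + d⁻ + 1 ≡ a → d⁺ ≤ d⁻ → σ ≤ s →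
    2 * n + 1 ≤ 2 * s + a + 2 * β
  many-arcs-to-B {n} {σ} {d⁺} {β} {d⁻} {a} {s} n≡ a≡ d⁺≤d⁻ σ≤s = ≤-by-contradiction λ h →
    infeasible 0 (h ⊕ 2 ⊗ ≤e n≡ ⊕ ≤e a≡ ⊕ d⁺≤d⁻ ⊕ 2 ⊗ σ≤s)
      (solve (n ∷ s ∷ a ∷ σ ∷ d⁺ ∷ d⁻ ∷ β ∷ []))

  B-overfull : Census n s a b c e δ σx σy →
    2 * n + 1 ≤ 2 * s + a + 2 * βA → 2 * n + 1 ≤ 2 * s + c + 2 * βC → βA + βC ≤ b → 2 * s ≤ n → ⊥
  B-overfull {n} {s} {a} {b} {c} {e} {δ} {σx} {σy} {βA} {βC} census hA hC βA+βC≤b 2s≤n =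
    infeasible 1 (hA ⊕ hC ⊕ 2 ⊗ βA+βC≤b ⊕ 2 ⊗ ≥e order ⊕ ≤e outdeg-x ⊕ ≤e indeg-y ⊕
                  2 ⊗ δ≤1 ⊕ σx≤s ⊕ σy≤s ⊕ 2 ⊗ 2s≤n)
      (solve (n ∷ s ∷ a ∷ b ∷ c ∷ e ∷ δ ∷ σx ∷ σy ∷ βA ∷ βC ∷ []))
    where open Census census

  census-lower-bound : Census n s a b c e δ σx σy →
    2 * n + 1 ≤ 2 * s + a + 2 * βA → 2 * n + 1 ≤ 2 * s + c + 2 * βC → βA ≤ b → βC ≤ b →
    2 * n + 6 ≤ 6 * δ + 3 * σx + 3 * σy + 2 * e
  census-lower-bound {n} {s} {a} {b} {c} {e} {δ} {σx} {σy} {βA} {βC} census hA hC βA≤b βC≤b =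
    ≤-by-contradiction λ h →
      infeasible 0 (hA ⊕ hC ⊕ 2 ⊗ βA≤b ⊕ 2 ⊗ βC≤b ⊕ 4 ⊗ ≥e order ⊕ 3 ⊗ ≤e outdeg-x ⊕ 3 ⊗ ≤e indeg-y ⊕ h)
        (solve (n ∷ s ∷ a ∷ b ∷ c ∷ e ∷ δ ∷ σx ∷ σy ∷ βA ∷ βC ∷ []))
    where open Census census

  record Tight (n s a b c e δ σx σy : ℕ) : Set where
    field
      δ≡1      : δ ≡ 1
      e≡1      : e ≡ 1
      σx≡s     : σx ≡ s
      σy≡s     : σy ≡ s
      n≡3s+1   : n ≡ 3 * s + 1
      a+1≡2s   : a + 1 ≡ 2 * s
      c+1≡2s   : c + 1 ≡ 2 * s
      b≡s+2    : b ≡ s + 2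

  tight : Census n s a b c e δ σx σy → 2 * n + 6 ≤ 6 * δ + 3 * σx + 3 * σy + 2 * e → 3 * s + 1 ≤ n →
    Tight n s a b c e δ σx σy
  tight {n} {s} {a} {b} {c} {e} {δ} {σx} {σy} census key 3s+1≤n = record
    { δ≡1 = δ≡1 ; e≡1 = e≡1 ; σx≡s = σx≡s ; σy≡s = σy≡s ; n≡3s+1 = n≡3s+1
    ; a+1≡2s = a+1≡2s ; c+1≡2s = c+1≡2s ; b≡s+2 = b≡s+2 }
    where
    open Census census
    δ≡1 : δ ≡ 1
    δ≡1 = ≤-antisym δ≤1 (≤-by-contradiction λ h →
      infeasible 5 (key ⊕ 6 ⊗ h ⊕ 3 ⊗ σx≤s ⊕ 3 ⊗ σy≤s ⊕ 2 ⊗ e≤1 ⊕ 2 ⊗ 3s+1≤n)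
        (solve (n ∷ s ∷ e ∷ δ ∷ σx ∷ σy ∷ [])))
    e≡1 : e ≡ 1
    e≡1 = ≤-antisym e≤1 (≤-by-contradiction λ h →
      infeasible 1 (key ⊕ 6 ⊗ δ≤1 ⊕ 3 ⊗ σx≤s ⊕ 3 ⊗ σy≤s ⊕ 2 ⊗ h ⊕ 2 ⊗ 3s+1≤n)
        (solve (n ∷ s ∷ e ∷ δ ∷ σx ∷ σy ∷ [])))
    σx≡s : σx ≡ s
    σx≡s = ≤-antisym σx≤s (≤-by-contradiction λ h →
      infeasible 2 (key ⊕ 6 ⊗ δ≤1 ⊕ 3 ⊗ h ⊕ 3 ⊗ σy≤s ⊕ 2 ⊗ e≤1 ⊕ 2 ⊗ 3s+1≤n)
        (solve (n ∷ s ∷ e ∷ δ ∷ σx ∷ σy ∷ [])))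
    σy≡s : σy ≡ s
    σy≡s = ≤-antisym σy≤s (≤-by-contradiction λ h →
      infeasible 2 (key ⊕ 6 ⊗ δ≤1 ⊕ 3 ⊗ σx≤s ⊕ 3 ⊗ h ⊕ 2 ⊗ e≤1 ⊕ 2 ⊗ 3s+1≤n)
        (solve (n ∷ s ∷ e ∷ δ ∷ σx ∷ σy ∷ [])))
    n≡3s+1 : n ≡ 3 * s + 1
    n≡3s+1 = ≤-antisym (≤-by-contradiction λ h →
      infeasible 1 (key ⊕ 6 ⊗ δ≤1 ⊕ 3 ⊗ σx≤s ⊕ 3 ⊗ σy≤s ⊕ 2 ⊗ e≤1 ⊕ 2 ⊗ h)
        (solve (n ∷ s ∷ e ∷ δ ∷ σx ∷ σy ∷ []))) 3s+1≤n
    a+1≡2s : a + 1 ≡ 2 * s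
    a+1≡2s = ≤-antisym
      (≤-by-contradiction λ h → infeasible 0
        (h ⊕ ≥e outdeg-x ⊕ ≤e n≡3s+1 ⊕ ≥e δ≡1 ⊕ ≥e σx≡s ⊕ ≥e e≡1) (solve (n ∷ s ∷ a ∷ e ∷ δ ∷ σx ∷ [])))
      (≤-by-contradiction λ h → infeasible 0
        (h ⊕ ≤e outdeg-x ⊕ ≥e n≡3s+1 ⊕ ≤e δ≡1 ⊕ ≤e σx≡s ⊕ ≤e e≡1) (solve (n ∷ s ∷ a ∷ e ∷ δ ∷ σx ∷ [])))
    c+1≡2s : c + 1 ≡ 2 * s
    c+1≡2s = ≤-antisym
      (≤-by-contradiction λ h → infeasible 0
        (h ⊕ ≥e indeg-y ⊕ ≤e n≡3s+1 ⊕ ≥e δ≡1 ⊕ ≥e σy≡s ⊕ ≥e e≡1) (solve (n ∷ s ∷ c ∷ e ∷ δ ∷ σy ∷ [])))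
      (≤-by-contradiction λ h → infeasible 0
        (h ⊕ ≤e indeg-y ⊕ ≥e n≡3s+1 ⊕ ≤e δ≡1 ⊕ ≤e σy≡s ⊕ ≤e e≡1) (solve (n ∷ s ∷ c ∷ e ∷ δ ∷ σy ∷ [])))
    b≡s+2 : b ≡ s + 2
    b≡s+2 = ≤-antisym
      (≤-by-contradiction λ h → infeasible 0
        (h ⊕ ≥e order ⊕ 2 ⊗ ≤e n≡3s+1 ⊕ ≥e a+1≡2s ⊕ ≥e c+1≡2s ⊕ ≥e e≡1) (solve (n ∷ s ∷ a ∷ b ∷ c ∷ e ∷ [])))
      (≤-by-contradiction λ h → infeasible 0
        (h ⊕ ≤e order ⊕ 2 ⊗ ≥e n≡3s+1 ⊕ ≤e a+1≡2s ⊕ ≤e c+1≡2s ⊕ ≤e e≡1) (solve (n ∷ s ∷ a ∷ b ∷ c ∷ e ∷ [])))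

  module _ (n≡3s+1 : n ≡ 3 * s + 1) (a+1≡2s : a + 1 ≡ 2 * s) (b≡s+2 : b ≡ s + 2)
           (n≡ : n ≡ σ + (d⁺ + β)) (a≡ : d⁺ + d⁻ + 1 ≡ a) (σ≤s : σ ≤ s) (β≤b : β ≤ b) where

    tight-vertex-balanced : d⁻ ≤ d⁺
    tight-vertex-balanced = ≤-by-contradiction λ h → infeasible 0
      (h ⊕ ≤e a≡ ⊕ ≤e a+1≡2s ⊕ 2 ⊗ (≥e n≡3s+1 ⊕ ≤e n≡ ⊕ σ≤s ⊕ β≤b ⊕ ≤e b≡s+2))
      (solve (n ∷ s ∷ a ∷ b ∷ σ ∷ d⁺ ∷ d⁻ ∷ β ∷ []))

    tight-vertex-saturated : d⁻ ≡ d⁺ → σ ≡ s × β ≡ b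
    tight-vertex-saturated d⁻≡d⁺ =
      ≤-antisym σ≤s (≤-by-contradiction λ h → infeasible 1
        (2 ⊗ (h ⊕ ≥e n≡3s+1 ⊕ ≤e n≡ ⊕ β≤b ⊕ ≤e b≡s+2) ⊕ ≤e a≡ ⊕ ≥e d⁻≡d⁺ ⊕ ≤e a+1≡2s)
        (solve (n ∷ s ∷ a ∷ b ∷ σ ∷ d⁺ ∷ d⁻ ∷ β ∷ []))) ,
      ≤-antisym β≤b (≤-by-contradiction λ h → infeasible 1
        (2 ⊗ (h ⊕ ≥e n≡3s+1 ⊕ ≤e n≡ ⊕ σ≤s ⊕ ≤e b≡s+2) ⊕ ≤e a≡ ⊕ ≥e d⁻≡d⁺ ⊕ ≤e a+1≡2s)
        (solve (n ∷ s ∷ a ∷ b ∷ σ ∷ d⁺ ∷ d⁻ ∷ β ∷ [])))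

  2s≤n∧5≤n⇒s+3≤n : 2 * s ≤ n → 5 ≤ n → s + 3 ≤ n
  2s≤n∧5≤n⇒s+3≤n {s} {n} 2s≤n 5≤n = ≤-by-contradiction λ h →
    infeasible 0 (2 ⊗ h ⊕ 2s≤n ⊕ 5≤n) (solve (s ∷ n ∷ []))

  3s+1≤n∧3≤n⇒s+3≤n : 3 * s + 1 ≤ n → 3 ≤ n → s + 3 ≤ n
  3s+1≤n∧3≤n⇒s+3≤n {s} {n} 3s+1≤n 3≤n = ≤-by-contradiction λ h →
    infeasible 0 (3 ⊗ h ⊕ 3s+1≤n ⊕ 2 ⊗ 3≤n) (solve (s ∷ n ∷ []))

  a+1≡2s⇒1≤s : a + 1 ≡ 2 * s → 1 ≤ s
  a+1≡2s⇒1≤s {a} {zero} a+1≡0 = contradiction (trans (+-comm 1 a) a+1≡0) λ ()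
  a+1≡2s⇒1≤s {s = suc s} _ = s≤s z≤n

  a+1≡2s⇒a≡2s∸1 : a + 1 ≡ 2 * s → a ≡ 2 * s ∸ 1
  a+1≡2s⇒a≡2s∸1 {a} a+1≡2s = sym (trans (cong (_∸ 1) (sym a+1≡2s)) (m+n∸n≡m a 1))

  ≤∸1⇒+1≤ : s ≤ n ∸ 1 → 1 ≤ n → s + 1 ≤ n
  ≤∸1⇒+1≤ {s} {n} s≤n∸1 1≤n = ≤-trans (+-monoˡ-≤ 1 s≤n∸1) (≤-reflexive (m∸n+n≡m 1≤n))

  n≡3s+1⇒2n+1≡6s+3 : n ≡ 3 * s + 1 → 2 * n + 1 ≡ 6 * s + 3
  n≡3s+1⇒2n+1≡6s+3 {n} {s} refl = solve (s ∷ [])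

path3-reverse : ∀ {m} {T : Tournament m} {S x y} → Path3 (reverse T) S y x → Path3 T S x y
path3-reverse (a , b , a∉S , b∉S , y≢a , y≢b , y≢x , a≢b , a≢x , b≢x , y←a , a←b , b←x) =
  b , a , b∉S , a∉S , b≢x ∘ sym , a≢x ∘ sym , y≢x ∘ sym , a≢b ∘ sym , y≢b ∘ sym , y≢a ∘ sym ,
  b←x , a←b , y←a

path3? : ∀ {m} (T : Tournament m) S x y → Dec (Path3 T S x y)
path3? T S x y = any? λ a → any? λ b →
  ¬? (a ∈? S) ×-dec ¬? (b ∈? S) ×-dec
  ¬? (x ≟ a) ×-dec ¬? (x ≟ b) ×-dec ¬? (x ≟ y) ×-dec ¬? (a ≟ b) ×-dec ¬? (a ≟ y) ×-dec ¬? (b ≟ y) ×-dec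
  arc T x a Bool.≟ true ×-dec arc T a b Bool.≟ true ×-dec arc T b y Bool.≟ true

path4? : ∀ {m} (T : Tournament m) S x y → Dec (Path4 T S x y)
path4? T S x y = any? λ a → any? λ b → any? λ c →
  ¬? (a ∈? S) ×-dec ¬? (b ∈? S) ×-dec ¬? (c ∈? S) ×-dec
  ¬? (x ≟ a) ×-dec ¬? (x ≟ b) ×-dec ¬? (x ≟ c) ×-dec ¬? (x ≟ y) ×-dec
  ¬? (a ≟ b) ×-dec ¬? (a ≟ c) ×-dec ¬? (a ≟ y) ×-dec ¬? (b ≟ c) ×-dec ¬? (b ≟ y) ×-dec ¬? (c ≟ y) ×-dec
  arc T x a Bool.≟ true ×-dec arc T a b Bool.≟ true ×-dec arc T b c Bool.≟ true ×-dec arc T c y Bool.≟ true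

-- Classification of the vertices relative to x and y

-- The parts of the partition in the definition of 𝒢, the part kZ being {z}.
Kind : Set
Kind = Fin 7

pattern kx = zero
pattern ky = suc zero
pattern kS = suc (suc zero)
pattern kA = suc (suc (suc zero))
pattern kZ = suc (suc (suc (suc zero)))
pattern kC = suc (suc (suc (suc (suc zero))))
pattern kB = suc (suc (suc (suc (suc (suc zero)))))

classify : (=x =y ∈S x→ →y : Bool) → Kind
classify true  _     _     _     _     = kx
classify false true  _     _     _     = ky
classify false false true  _     _     = kS
classify false false false true  false = kA
classify false false false true  true  = kZ
classify false false false false true  = kC
classify false false false false false = kB

swapKind : Kind → Kind
swapKind kx = ky
swapKind ky = kx
swapKind kA = kC
swapKind kC = kA
swapKind k  = k

classify-swap : ∀ =x =y ∈S x→ →y → (=x ≡ true → =y ≡ false) →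
  classify =y =x ∈S →y x→ ≡ swapKind (classify =x =y ∈S x→ →y)
classify-swap true  true  _     _     _     excl with () ← excl refl
classify-swap true  false _     _     _     _    = refl
classify-swap false true  _     _     _     _    = refl
classify-swap false false true  _     _     _    = refl
classify-swap false false false true  false _    = refl
classify-swap false false false true  true  _    = refl
classify-swap false false false false true  _    = refl
classify-swap false false false false false _    = refl

swapKind-involutive : ∀ k → swapKind (swapKind k) ≡ k
swapKind-involutive kx = refl
swapKind-involutive ky = refl
swapKind-involutive kS = refl
swapKind-involutive kA = refl
swapKind-involutive kZ = refl
swapKind-involutive kC = refl
swapKind-involutive kB = refl

swapKind-≟ : ∀ k l → does (swapKind k ≟ l) ≡ does (k ≟ swapKind l)
swapKind-≟ k l with swapKind k ≟ l | k ≟ swapKind l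
... | yes _    | yes _    = refl
... | no  _    | no  _    = refl
... | yes refl | no k≢    = ⊥-elim (k≢ (sym (swapKind-involutive k)))
... | no  ≢l   | yes refl = ⊥-elim (≢l (swapKind-involutive l))

module Classification {n : ℕ} (T : Tournament (2 * n + 1)) (reg : Regular T) (S : Subset (2 * n + 1))
  (x y : Fin (2 * n + 1)) (x≢y : x ≢ y) (x∉S : x ∉ S) (y∉S : y ∉ S) (no-path : ¬ Path3 T S x y) where

  V : Set
  V = Fin (2 * n + 1)

  record Free (v : V) : Set where
    field
      ∉S : v ∉ S
      ≢x : v ≢ x
      ≢y : v ≢ y
  open Free public

  kind : V → Kind
  kind v = classify (does (v ≟ x)) (does (v ≟ y)) (lookup S v) (arc T x v) (arc T v y)

  Meaning : Kind → V → Set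
  Meaning kx v = v ≡ x
  Meaning ky v = v ≡ y
  Meaning kS v = v ∈ S
  Meaning kA v = Free v × (T ⟶ x) v × (T ⟶ y) v
  Meaning kZ v = Free v × (T ⟶ x) v × (T ⟶ v) y
  Meaning kC v = Free v × (T ⟶ v) x × (T ⟶ v) y
  Meaning kB v = Free v × (T ⟶ v) x × (T ⟶ y) v

  free : ∀ {v} → v ≢ x → v ≢ y → lookup S v ≡ false → Free v
  free v≢x v≢y Sv = record
    { ∉S = λ v∈S → contradiction (trans (sym (∈⇒lookup v∈S)) Sv) λ () ; ≢x = v≢x ; ≢y = v≢y }

  kind-meaning : ∀ v → Meaning (kind v) v
  kind-meaning v with v ≟ x | v ≟ y | lookup S v in Sv | arc T x v in x→v | arc T v y in v→y
  ... | yes v≡x | _       | _     | _     | _     = v≡x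
  ... | no  _   | yes v≡y | _     | _     | _     = v≡y
  ... | no  _   | no  _   | true  | _     | _     = lookup⇒∈ Sv
  ... | no  v≢x | no  v≢y | false | true  | false = free v≢x v≢y Sv , x→v , ¬arc⇒arc T v≢y v→y
  ... | no  v≢x | no  v≢y | false | true  | true  = free v≢x v≢y Sv , x→v , v→y
  ... | no  v≢x | no  v≢y | false | false | true  = free v≢x v≢y Sv , ¬arc⇒arc T (v≢x ∘ sym) x→v , v→y
  ... | no  v≢x | no  v≢y | false | false | false =
    free v≢x v≢y Sv , ¬arc⇒arc T (v≢x ∘ sym) x→v , ¬arc⇒arc T v≢y v→y

  kind-x : kind x ≡ kx
  kind-x rewrite dec-true (x ≟ x) refl = refl

  kind-y : kind y ≡ ky
  kind-y rewrite dec-false (y ≟ x) (x≢y ∘ sym) | dec-true (y ≟ y) refl = refl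

  kind-S : ∀ {v} → v ∈ S → kind v ≡ kS
  kind-S {v} v∈S rewrite dec-false (v ≟ x) (λ { refl → x∉S v∈S }) | dec-false (v ≟ y) (λ { refl → y∉S v∈S })
                       | ∈⇒lookup v∈S = refl

  meaning : ∀ {k v} → v ∈ part kind k → Meaning k v
  meaning {k} {v} v∈ = subst (λ l → Meaning l v) (∈-part kind v∈) (kind-meaning v)

  A B C Z : Subset (2 * n + 1)
  A = part kind kA
  B = part kind kB
  C = part kind kC
  Z = part kind kZ

  kind-∉ : ∀ {k l v} → kind v ≡ k → k ≢ l → v ∉ part kind l
  kind-∉ kind-v k≢l v∈ = k≢l (trans (sym kind-v) (∈-part kind v∈))

  different-kinds : ∀ {k l u v} → u ∈ part kind k → v ∈ part kind l → k ≢ l → u ≢ v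
  different-kinds u∈ v∈ k≢l refl = k≢l (trans (sym (∈-part kind u∈)) (∈-part kind v∈))

  x⟶A : ∀ {v} → v ∈ A → (T ⟶ x) v
  x⟶A v∈A = proj₁ (proj₂ (meaning v∈A))

  y⟶A : ∀ {v} → v ∈ A → (T ⟶ y) v
  y⟶A v∈A = proj₂ (proj₂ (meaning v∈A))

  B⟶x : ∀ {u} → u ∈ B → (T ⟶ u) x
  B⟶x u∈B = proj₁ (proj₂ (meaning u∈B))

  y⟶B : ∀ {v} → v ∈ B → (T ⟶ y) v
  y⟶B v∈B = proj₂ (proj₂ (meaning v∈B))

  C⟶x : ∀ {u} → u ∈ C → (T ⟶ u) x
  C⟶x u∈C = proj₁ (proj₂ (meaning u∈C))

  C⟶y : ∀ {u} → u ∈ C → (T ⟶ u) y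
  C⟶y u∈C = proj₂ (proj₂ (meaning u∈C))

  no-arc : ∀ {u v} → Free u → Free v → u ≢ v → (T ⟶ x) u → (T ⟶ v) y → arc T u v ≡ false
  no-arc {u} {v} free-u free-v u≢v x→u v→y with arc T u v in u→v
  ... | false = refl
  ... | true  = ⊥-elim (no-path (u , v , ∉S free-u , ∉S free-v , ≢x free-u ∘ sym , ≢x free-v ∘ sym , x≢y ,
                                 u≢v , ≢y free-u , ≢y free-v , x→u , u→v , v→y))

  countIn-singleton : ∀ {k w} → (∀ v → kind v ≡ k → v ≡ w) → kind w ≡ k →
    (g : V → Bool) → countIn (part kind k) g ≡ toℕ (g w)
  countIn-singleton {k} {w} only-w kind-w g =
    trans (count-cong λ v → cong (_∧ g v) (lookup-part v)) (count-single w g)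
    where
    lookup-part : ∀ v → lookup (part kind k) v ≡ does (w ≟ v)
    lookup-part v with w ≟ v
    ... | yes refl = ∈⇒lookup (part-∈ kind kind-w)
    ... | no  w≢v with lookup (part kind k) v in v∈
    ...   | true  = ⊥-elim (w≢v (sym (only-w v (∈-part kind (lookup⇒∈ v∈)))))
    ...   | false = refl

  countIn-kS : (g : V → Bool) → countIn (part kind kS) g ≡ countIn S g
  countIn-kS g = count-cong λ v → cong (_∧ g v) (⇔→≡ {z = true} (mk⇔
    (λ v∈ → ∈⇒lookup (meaning (lookup⇒∈ v∈)))
    (λ v∈S → ∈⇒lookup (part-∈ kind (kind-S (lookup⇒∈ v∈S))))))

  count-by-kind : ∀ {g vx vy vS vA vZ vC vB} →
    toℕ (g x) ≡ vx → toℕ (g y) ≡ vy → countIn S g ≡ vS → countIn A g ≡ vA → countIn Z g ≡ vZ →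
    countIn C g ≡ vC → countIn B g ≡ vB → count g ≡ vx + (vy + (vS + (vA + (vZ + (vC + vB)))))
  count-by-kind {g} ex ey eS eA eZ eC eB = trans (count-partition kind g)
    (cong₂ _+_ (trans (countIn-singleton only-x kind-x g) ex)
    (cong₂ _+_ (trans (countIn-singleton only-y kind-y g) ey)
    (cong₂ _+_ (trans (countIn-kS g) eS)
    (cong₂ _+_ eA (cong₂ _+_ eZ (cong₂ _+_ eC (trans (+-identityʳ _) eB)))))))
    where
    only-x : ∀ v → kind v ≡ kx → v ≡ x
    only-x v kv≡ = subst (λ l → Meaning l v) kv≡ (kind-meaning v)
    only-y : ∀ v → kind v ≡ ky → v ≡ y
    only-y v kv≡ = subst (λ l → Meaning l v) kv≡ (kind-meaning v)

  vertex-count : 2 * n + 1 ≡ 1 + (1 + (∣ S ∣ + (∣ A ∣ + (∣ Z ∣ + (∣ C ∣ + ∣ B ∣)))))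
  vertex-count = trans (sym (count-true _))
    (count-by-kind refl refl (countIn-true S) (countIn-true A) (countIn-true Z)
                             (countIn-true C) (countIn-true B))

  outdeg-x : n ≡ toℕ (arc T x y) + (outdegIn T S x + (∣ A ∣ + ∣ Z ∣))
  outdeg-x = begin
    n                 ≡⟨ regular⇒outdeg≡n {n} T reg x ⟨
    outdeg T x        ≡⟨ count-by-kind (cong toℕ (irrefl T x)) refl refl
                           (countIn-all λ _ → x⟶A) (countIn-all λ _ v∈Z → proj₁ (proj₂ (meaning v∈Z)))
                           (countIn-false λ _ → arc-asym T ∘ C⟶x) (countIn-false λ _ → arc-asym T ∘ B⟶x) ⟩
    toℕ (arc T x y) + (outdegIn T S x + (∣ A ∣ + (∣ Z ∣ + 0)))
                      ≡⟨ cong (λ t → toℕ (arc T x y) + (outdegIn T S x + (∣ A ∣ + t))) (+-identityʳ ∣ Z ∣) ⟩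
    toℕ (arc T x y) + (outdegIn T S x + (∣ A ∣ + ∣ Z ∣)) ∎
    where open ≡-Reasoning

  outdeg-A : ∀ {u} → u ∈ A → n ≡ outdegIn T S u + (outdegIn T A u + outdegIn T B u)
  outdeg-A {u} u∈A = trans (sym (regular⇒outdeg≡n {n} T reg u)) (count-by-kind
    (cong toℕ (arc-asym T (x⟶A u∈A))) (cong toℕ (arc-asym T (y⟶A u∈A))) refl refl
    (countIn-false λ _ v∈Z → no-arc (proj₁ (meaning u∈A)) (proj₁ (meaning v∈Z)) (different-kinds u∈A v∈Z λ ())
                                     (x⟶A u∈A) (proj₂ (proj₂ (meaning v∈Z))))
    (countIn-false λ _ v∈C → no-arc (proj₁ (meaning u∈A)) (proj₁ (meaning v∈C)) (different-kinds u∈A v∈C λ ())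
                                     (x⟶A u∈A) (C⟶y v∈C))
    refl)

  Z-unique : ∀ {u v} → u ∈ Z → v ∈ Z → u ≡ v
  Z-unique {u} {v} u∈Z v∈Z with u ≟ v
  ... | yes u≡v = u≡v
  ... | no  u≢v = contradiction (trans (sym u→v) u↛v) λ ()
    where
    u→v : (T ⟶ u) v
    u→v = ¬arc⇒arc T (u≢v ∘ sym) (no-arc (proj₁ (meaning v∈Z)) (proj₁ (meaning u∈Z)) (u≢v ∘ sym)
                                         (proj₁ (proj₂ (meaning v∈Z))) (proj₂ (proj₂ (meaning u∈Z))))
    u↛v : arc T u v ≡ false
    u↛v = no-arc (proj₁ (meaning u∈Z)) (proj₁ (meaning v∈Z)) u≢v
                 (proj₁ (proj₂ (meaning u∈Z))) (proj₂ (proj₂ (meaning v∈Z)))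

  ∣Z∣≤1 : ∣ Z ∣ ≤ 1
  ∣Z∣≤1 = subst (_≤ 1) (sym (∣∣≡count Z)) (count-≤1 λ _ _ u∈Z v∈Z → Z-unique (lookup⇒∈ u∈Z) (lookup⇒∈ v∈Z))

  ∃A-vertex-dominating-B : ∣ S ∣ + 3 ≤ n → ∃ λ a → a ∈ A × 2 * n + 1 ≤ 2 * ∣ S ∣ + ∣ A ∣ + 2 * outdegIn T B a
  ∃A-vertex-dominating-B room with ∃-outdegIn≤indegIn T
                      (Arithmetic.nonempty outdeg-x (toℕ≤1 (arc T x y)) (countIn-≤ S (arc T x)) ∣Z∣≤1 room)
  ... | a , a∈A , out≤in = a , a∈A , Arithmetic.many-arcs-to-B (outdeg-A a∈A) (outdegIn+indegIn T a∈A) out≤in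
                                                           (countIn-≤ S (arc T a))

  module Saturated (n≡3s+1 : n ≡ 3 * ∣ S ∣ + 1) (a+1≡2s : ∣ A ∣ + 1 ≡ 2 * ∣ S ∣)
                   (b≡s+2 : ∣ B ∣ ≡ ∣ S ∣ + 2) where

    A-balanced : ∀ u → u ∈ A → indegIn T A u ≤ outdegIn T A u
    A-balanced u u∈A = Arithmetic.tight-vertex-balanced n≡3s+1 a+1≡2s b≡s+2 (outdeg-A u∈A)
      (outdegIn+indegIn T u∈A) (countIn-≤ S (arc T u)) (countIn-≤ B (arc T u))

    A-regular : RegularOn T A
    A-regular = indegIn≤outdegIn⇒regularOn T A-balanced

    A-saturated : ∀ {u} → u ∈ A → outdegIn T S u ≡ ∣ S ∣ × outdegIn T B u ≡ ∣ B ∣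
    A-saturated {u} u∈A = Arithmetic.tight-vertex-saturated n≡3s+1 a+1≡2s b≡s+2 (outdeg-A u∈A)
      (outdegIn+indegIn T u∈A) (countIn-≤ S (arc T u)) (countIn-≤ B (arc T u))
      (sym (A-regular u u∈A))

    A⟶S : ∀ {u v} → u ∈ A → v ∈ S → (T ⟶ u) v
    A⟶S {u} {v} u∈A = countIn-full (≤-reflexive (sym (proj₁ (A-saturated u∈A)))) v

    A⟶B : ∀ {u v} → u ∈ A → v ∈ B → (T ⟶ u) v
    A⟶B {u} {v} u∈A = countIn-full (≤-reflexive (sym (proj₂ (A-saturated u∈A)))) v

-- Both classifications: part (ii) and the extremal case of part (i)

module NoPath3 {n : ℕ} (T : Tournament (2 * n + 1)) (reg : Regular T) (S : Subset (2 * n + 1))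
  (x y : Fin (2 * n + 1)) (x≢y : x ≢ y) (x∉S : x ∉ S) (y∉S : y ∉ S) (no-path : ¬ Path3 T S x y) where

  open Classification {n} T reg S x y x≢y x∉S y∉S no-path public
  open Arithmetic

  -- Reversing all arcs and swapping x and y exchanges A and C, so facts about C are read off
  -- from this second classification.
  module R = Classification {n} (reverse T) (reverse-regular T reg) S y x (x≢y ∘ sym) y∉S x∉S
                            (no-path ∘ path3-reverse {T = T})

  R-kind : ∀ v → R.kind v ≡ swapKind (kind v)
  R-kind v = classify-swap (does (v ≟ x)) (does (v ≟ y)) (lookup S v) (arc T x v) (arc T v y) exclusive
    where
    exclusive : does (v ≟ x) ≡ true → does (v ≟ y) ≡ false
    exclusive _ with v ≟ x
    ... | yes refl = dec-false (x ≟ y) x≢y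

  R-part : ∀ k → part R.kind k ≡ part kind (swapKind k)
  R-part k = tabulate-cong λ v → trans (cong (λ j → does (j ≟ k)) (R-kind v)) (swapKind-≟ (kind v) k)

  census : Census n (∣ S ∣) (∣ A ∣) (∣ B ∣) (∣ C ∣) (∣ Z ∣) (toℕ (arc T x y)) (outdegIn T S x) (indegIn T S y)
  census = record
    { order    = vertex-count
    ; outdeg-x = outdeg-x
    ; indeg-y  = subst₂ (λ R-A R-Z → n ≡ toℕ (arc T x y) + (indegIn T S y + (∣ R-A ∣ + ∣ R-Z ∣)))
                        (R-part kA) (R-part kZ) R.outdeg-x
    ; δ≤1      = toℕ≤1 (arc T x y)
    ; e≤1      = ∣Z∣≤1
    ; σx≤s     = countIn-≤ S (arc T x)
    ; σy≤s     = countIn-≤ S (λ v → arc T v y)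
    }

  ∃C-vertex-dominated-by-B : ∣ S ∣ + 3 ≤ n → ∃ λ c → c ∈ C × 2 * n + 1 ≤ 2 * ∣ S ∣ + ∣ C ∣ + 2 * indegIn T B c
  ∃C-vertex-dominated-by-B room = c , subst (c ∈_) (R-part kA) c∈R-A , subst₂ bound (R-part kA) (R-part kB) hC
    where
    found = R.∃A-vertex-dominating-B room
    c = proj₁ found
    c∈R-A = proj₁ (proj₂ found)
    hC = proj₂ (proj₂ found)
    bound : Subset (2 * n + 1) → Subset (2 * n + 1) → Set
    bound X Y = 2 * n + 1 ≤ 2 * ∣ S ∣ + ∣ X ∣ + 2 * indegIn T Y c

  B-split : ∀ {a c} → ¬ Path4 T S x y → a ∈ A → c ∈ C → outdegIn T B a + indegIn T B c ≤ ∣ B ∣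
  B-split {a} {c} no-path4 a∈A c∈C =
    subst (outdegIn T B a + indegIn T B c ≤_) (countIn-true B) (count-+-≤ pointwise)
    where
    pointwise : ∀ v → toℕ (lookup B v ∧ arc T a v) + toℕ (lookup B v ∧ arc T v c) ≤ toℕ (lookup B v ∧ true)
    pointwise v with lookup B v in v∈B | arc T a v in a→v | arc T v c in v→c
    ... | false | _     | _     = z≤n
    ... | true  | false | _     = toℕ≤1 _
    ... | true  | true  | false = ≤-refl
    ... | true  | true  | true  = ⊥-elim (no-path4
      (a , v , c , ∉S free-a , ∉S free-v , ∉S free-c , ≢x free-a ∘ sym , ≢x free-v ∘ sym , ≢x free-c ∘ sym ,
       x≢y , different-kinds a∈A (lookup⇒∈ v∈B) (λ ()) , different-kinds a∈A c∈C (λ ()) , ≢y free-a ,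
       different-kinds (lookup⇒∈ v∈B) c∈C (λ ()) , ≢y free-v , ≢y free-c ,
       x⟶A a∈A , a→v , v→c , C⟶y c∈C))
      where
      free-a : Free a
      free-a = proj₁ (meaning a∈A)
      free-v : Free v
      free-v = proj₁ (meaning {kB} (lookup⇒∈ v∈B))
      free-c : Free c
      free-c = proj₁ (meaning c∈C)


  path4-exists : 2 * ∣ S ∣ ≤ n → 5 ≤ n → ¬ ¬ Path4 T S x y
  path4-exists 2s≤n 5≤n no-path4 =
    B-overfull {βA = outdegIn T B a} {βC = indegIn T B c} census hA hC (B-split no-path4 a∈A c∈C) 2s≤n
    where
    A-witness = ∃A-vertex-dominating-B (2s≤n∧5≤n⇒s+3≤n 2s≤n 5≤n)
    a = proj₁ A-witness
    a∈A = proj₁ (proj₂ A-witness)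
    hA = proj₂ (proj₂ A-witness)
    C-witness = ∃C-vertex-dominated-by-B (2s≤n∧5≤n⇒s+3≤n 2s≤n 5≤n)
    c = proj₁ C-witness
    c∈C = proj₁ (proj₂ C-witness)
    hC = proj₂ (proj₂ C-witness)

  counts-tight : 3 * ∣ S ∣ + 1 ≤ n → 3 ≤ n →
    Tight n (∣ S ∣) (∣ A ∣) (∣ B ∣) (∣ C ∣) (∣ Z ∣) (toℕ (arc T x y)) (outdegIn T S x) (indegIn T S y)
  counts-tight 3s+1≤n 3≤n = tight census
    (census-lower-bound {βA = outdegIn T B a} {βC = indegIn T B c} census hA hC
       (countIn-≤ B (arc T a)) (countIn-≤ B (λ v → arc T v c)))
    3s+1≤n
    where
    A-witness = ∃A-vertex-dominating-B (3s+1≤n∧3≤n⇒s+3≤n 3s+1≤n 3≤n)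
    a = proj₁ A-witness
    hA = proj₂ (proj₂ A-witness)
    C-witness = ∃C-vertex-dominated-by-B (3s+1≤n∧3≤n⇒s+3≤n 3s+1≤n 3≤n)
    c = proj₁ C-witness
    hC = proj₂ (proj₂ C-witness)

  module Extremal (3s+1≤n : 3 * ∣ S ∣ + 1 ≤ n) (3≤n : 3 ≤ n) where

    tightness :
      Tight n (∣ S ∣) (∣ A ∣) (∣ B ∣) (∣ C ∣) (∣ Z ∣) (toℕ (arc T x y)) (outdegIn T S x) (indegIn T S y)
    tightness = counts-tight 3s+1≤n 3≤n

    open Tight tightness public

    module L-sat = Saturated n≡3s+1 a+1≡2s b≡s+2
    module R-sat = R.Saturated n≡3s+1
      (subst (λ X → ∣ X ∣ + 1 ≡ 2 * ∣ S ∣) (sym (R-part kA)) c+1≡2s)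
      (subst (λ X → ∣ X ∣ ≡ ∣ S ∣ + 2) (sym (R-part kB)) b≡s+2)

    C⇒R-A : ∀ {v} → v ∈ C → v ∈ R.A
    C⇒R-A {v} = subst (v ∈_) (sym (R-part kA))

    B⇒R-B : ∀ {v} → v ∈ B → v ∈ R.B
    B⇒R-B {v} = subst (v ∈_) (sym (R-part kB))

    z-witness : ∃ λ z → lookup Z z ≡ true
    z-witness = count-witness (≤-reflexive (sym (trans (sym (∣∣≡count Z)) e≡1)))

    z : V
    z = proj₁ z-witness

    z∈Z : z ∈ Z
    z∈Z = lookup⇒∈ (proj₂ z-witness)

    free-z : Free z
    free-z = proj₁ (meaning z∈Z)

    x⟶z : (T ⟶ x) z
    x⟶z = proj₁ (proj₂ (meaning z∈Z))

    z⟶y : (T ⟶ z) y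
    z⟶y = proj₂ (proj₂ (meaning z∈Z))

    x⟶y : (T ⟶ x) y
    x⟶y = toℕ≡1 δ≡1

    x⟶S : ∀ {v} → v ∈ S → (T ⟶ x) v
    x⟶S {v} = countIn-full (≤-reflexive (sym σx≡s)) v

    S⟶y : ∀ {u} → u ∈ S → (T ⟶ u) y
    S⟶y {u} = countIn-full {g = λ v → arc T v y} (≤-reflexive (sym σy≡s)) u

    S⟶C : ∀ {u v} → u ∈ S → v ∈ C → (T ⟶ u) v
    S⟶C u∈S v∈C = R-sat.A⟶S (C⇒R-A v∈C) u∈S

    B⟶C : ∀ {u v} → u ∈ B → v ∈ C → (T ⟶ u) v
    B⟶C u∈B v∈C = R-sat.A⟶B (C⇒R-A v∈C) (B⇒R-B u∈B)

    C⟶A : ∀ {u v} → u ∈ C → v ∈ A → (T ⟶ u) v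
    C⟶A u∈C v∈A =
      ¬arc⇒arc T v≢u (no-arc (proj₁ (meaning v∈A)) (proj₁ (meaning u∈C)) v≢u (x⟶A v∈A) (C⟶y u∈C))
      where v≢u = different-kinds v∈A u∈C λ ()

    C⟶z : ∀ {u} → u ∈ C → (T ⟶ u) z
    C⟶z u∈C = ¬arc⇒arc T z≢u (no-arc free-z (proj₁ (meaning u∈C)) z≢u x⟶z (C⟶y u∈C))
      where z≢u = different-kinds z∈Z u∈C λ ()

    z⟶A : ∀ {v} → v ∈ A → (T ⟶ z) v
    z⟶A v∈A = ¬arc⇒arc T v≢z (no-arc (proj₁ (meaning v∈A)) free-z v≢z (x⟶A v∈A) z⟶y)
      where v≢z = different-kinds v∈A z∈Z λ ()

    C-regular : RegularOn T C
    C-regular u u∈C = sym (subst (RegularOn (reverse T)) (R-part kA) R-sat.A-regular u u∈C)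

    ∣C∣≡∣A∣ : ∣ C ∣ ≡ ∣ A ∣
    ∣C∣≡∣A∣ = +-cancelʳ-≡ 1 ∣ C ∣ ∣ A ∣ (trans c+1≡2s (sym a+1≡2s))

    zBS : Subset (2 * n + 1)
    zBS = ⁅ z ⁆ ∪ B ∪ S

    zBS-cases : ∀ {v} → v ∈ zBS → v ≡ z ⊎ v ∈ B ⊎ v ∈ S
    zBS-cases {v} v∈ = Sum.map (x∈⁅y⁆⇒x≡y z) (x∈p∪q⁻ B S) (x∈p∪q⁻ ⁅ z ⁆ (B ∪ S) v∈)

    zBS-∋ : ∀ {v} → v ∈ Z ⊎ v ∈ B ⊎ v ∈ S → v ∈ zBS
    zBS-∋ {v} (inj₁ v∈Z) = x∈p∪q⁺ {p = ⁅ z ⁆} {q = B ∪ S}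
                             (inj₁ (subst (_∈ ⁅ z ⁆) (Z-unique z∈Z v∈Z) (x∈⁅x⁆ z)))
    zBS-∋ {v} (inj₂ v∈BS) = x∈p∪q⁺ {p = ⁅ z ⁆} {q = B ∪ S} (inj₂ (x∈p∪q⁺ {p = B} {q = S} v∈BS))

    ∉zBS : ∀ {k v} → kind v ≡ k → k ≢ kZ → k ≢ kB → k ≢ kS → v ∉ zBS
    ∉zBS {k} {v} kind-v k≢Z k≢B k≢S v∈ = excluded (zBS-cases v∈)
      where
      excluded : v ≡ z ⊎ v ∈ B ⊎ v ∈ S → ⊥
      excluded (inj₁ refl)       = k≢Z (trans (sym kind-v) (∈-part kind z∈Z))
      excluded (inj₂ (inj₁ v∈B)) = k≢B (trans (sym kind-v) (∈-part kind v∈B))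
      excluded (inj₂ (inj₂ v∈S)) = k≢S (trans (sym kind-v) (kind-S v∈S))

    zBS-split : ∀ g → countIn zBS g + ((toℕ (g x) + toℕ (g y)) + (countIn A g + countIn C g)) ≡ count g
    zBS-split g = begin
      countIn zBS g + (gx + gy + (α + γ))    ≡⟨ cong (_+ (gx + gy + (α + γ))) zBS-part ⟩
      σ + (ζ + β) + (gx + gy + (α + γ))      ≡⟨ rearrange σ ζ β gx gy α γ ⟩
      gx + (gy + (σ + (α + (ζ + (γ + β)))))  ≡⟨ count-by-kind {g = g} refl refl refl refl refl refl refl ⟨
      count g                                ∎
      where
      open ≡-Reasoning
      gx = toℕ (g x)
      gy = toℕ (g y)
      σ = countIn S g
      α = countIn A g
      ζ = countIn Z g
      γ = countIn C g
      β = countIn B g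
      rearrange : ∀ σ ζ β gx gy α γ →
        σ + (ζ + β) + (gx + gy + (α + γ)) ≡ gx + (gy + (σ + (α + (ζ + (γ + β)))))
      rearrange = solve-∀
      zBS-part : countIn zBS g ≡ σ + (ζ + β)
      zBS-part = count-by-kind {g = λ v → lookup zBS v ∧ g v}
        (cong (λ b → toℕ (b ∧ g x)) (∉⇒lookup (∉zBS kind-x (λ ()) (λ ()) (λ ()))))
        (cong (λ b → toℕ (b ∧ g y)) (∉⇒lookup (∉zBS kind-y (λ ()) (λ ()) (λ ()))))
        (countIn-inside {X = S} {Y = zBS} {g = g} λ _ v∈S → zBS-∋ (inj₂ (inj₂ v∈S)))
        (countIn-outside {X = A} {Y = zBS} {g = g} λ _ v∈A → ∉zBS (∈-part kind v∈A) (λ ()) (λ ()) (λ ()))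
        (countIn-inside {X = Z} {Y = zBS} {g = g} λ _ v∈Z → zBS-∋ (inj₁ v∈Z))
        (countIn-outside {X = C} {Y = zBS} {g = g} λ _ v∈C → ∉zBS (∈-part kind v∈C) (λ ()) (λ ()) (λ ()))
        (countIn-inside {X = B} {Y = zBS} {g = g} λ _ v∈B → zBS-∋ (inj₂ (inj₁ v∈B)))

    -- Every vertex of {z} ∪ B ∪ S, in both directions, is joined to exactly one of x and y and to
    -- all of A or all of C; so its out- and in-degree inside {z} ∪ B ∪ S both equal n − 1 − |A|.
    Split : (V → Bool) → Set
    Split g = (toℕ (g x) + toℕ (g y) ≡ 1) × (countIn A g + countIn C g ≡ ∣ A ∣)

    zBS-degree : ∀ g → count g ≡ n → Split g → countIn zBS g + (1 + ∣ A ∣) ≡ n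
    zBS-degree g count≡n (xy≡1 , AC≡a) =
      trans (cong (countIn zBS g +_) (cong₂ _+_ (sym xy≡1) (sym AC≡a))) (trans (zBS-split g) count≡n)

    all-A-none-C : ∀ {g} → (∀ {v} → v ∈ A → g v ≡ true) → (∀ {v} → v ∈ C → g v ≡ false) →
      countIn A g + countIn C g ≡ ∣ A ∣
    all-A-none-C all none =
      trans (cong₂ _+_ (countIn-all {X = A} λ _ → all) (countIn-false {X = C} λ _ → none)) (+-identityʳ ∣ A ∣)

    none-A-all-C : ∀ {g} → (∀ {v} → v ∈ A → g v ≡ false) → (∀ {v} → v ∈ C → g v ≡ true) →
      countIn A g + countIn C g ≡ ∣ A ∣
    none-A-all-C none all =
      trans (cong₂ _+_ (countIn-false {X = A} λ _ → none) (countIn-all {X = C} λ _ → all)) ∣C∣≡∣A∣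

    zBS-splits : ∀ {u} → u ≡ z ⊎ u ∈ B ⊎ u ∈ S → Split (arc T u) × Split (λ v → arc T v u)
    zBS-splits (inj₁ refl) =
      (cong₂ _+_ (cong toℕ (arc-asym T x⟶z)) (cong toℕ z⟶y) ,
       all-A-none-C z⟶A (arc-asym T ∘ C⟶z)) ,
      (cong₂ _+_ (cong toℕ x⟶z) (cong toℕ (arc-asym T z⟶y)) ,
       none-A-all-C (arc-asym T ∘ z⟶A) C⟶z)
    zBS-splits (inj₂ (inj₁ u∈B)) =
      (cong₂ _+_ (cong toℕ (B⟶x u∈B)) (cong toℕ (arc-asym T (y⟶B u∈B))) ,
       none-A-all-C (λ v∈A → arc-asym T (L-sat.A⟶B v∈A u∈B)) (B⟶C u∈B)) ,
      (cong₂ _+_ (cong toℕ (arc-asym T (B⟶x u∈B))) (cong toℕ (y⟶B u∈B)) ,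
       all-A-none-C (λ v∈A → L-sat.A⟶B v∈A u∈B) (λ v∈C → arc-asym T (B⟶C u∈B v∈C)))
    zBS-splits (inj₂ (inj₂ u∈S)) =
      (cong₂ _+_ (cong toℕ (arc-asym T (x⟶S u∈S))) (cong toℕ (S⟶y u∈S)) ,
       none-A-all-C (λ v∈A → arc-asym T (L-sat.A⟶S v∈A u∈S)) (S⟶C u∈S)) ,
      (cong₂ _+_ (cong toℕ (x⟶S u∈S)) (cong toℕ (arc-asym T (S⟶y u∈S))) ,
       all-A-none-C (λ v∈A → L-sat.A⟶S v∈A u∈S) (λ v∈C → arc-asym T (S⟶C u∈S v∈C)))

    zBS-regular : RegularOn T zBS
    zBS-regular u u∈ = +-cancelʳ-≡ (1 + ∣ A ∣) (outdegIn T zBS u) (indegIn T zBS u) (trans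
      (zBS-degree (arc T u) (regular⇒outdeg≡n {n} T reg u) (proj₁ splits))
      (sym (zBS-degree (λ v → arc T v u) (regular⇒indeg≡n {n} T reg u) (proj₂ splits))))
      where splits = zBS-splits (zBS-cases u∈)

    cover : ∀ v → (v ≡ x) ⊎ (v ≡ y) ⊎ (v ≡ z) ⊎ (v ∈ A) ⊎ (v ∈ B) ⊎ (v ∈ C) ⊎ (v ∈ S)
    cover v = by-kind (kind v) refl
      where
      means : ∀ {k} → kind v ≡ k → Meaning k v
      means kind-v = subst (λ k → Meaning k v) kind-v (kind-meaning v)
      by-kind : ∀ k → kind v ≡ k → (v ≡ x) ⊎ (v ≡ y) ⊎ (v ≡ z) ⊎ (v ∈ A) ⊎ (v ∈ B) ⊎ (v ∈ C) ⊎ (v ∈ S)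
      by-kind kx kind-v = inj₁ (means kind-v)
      by-kind ky kind-v = inj₂ (inj₁ (means kind-v))
      by-kind kZ kind-v = inj₂ (inj₂ (inj₁ (Z-unique (part-∈ kind kind-v) z∈Z)))
      by-kind kA kind-v = inj₂ (inj₂ (inj₂ (inj₁ (part-∈ kind kind-v))))
      by-kind kB kind-v = inj₂ (inj₂ (inj₂ (inj₂ (inj₁ (part-∈ kind kind-v)))))
      by-kind kC kind-v = inj₂ (inj₂ (inj₂ (inj₂ (inj₂ (inj₁ (part-∈ kind kind-v))))))
      by-kind kS kind-v = inj₂ (inj₂ (inj₂ (inj₂ (inj₂ (inj₂ (means kind-v))))))

    in-𝒢 : InG T
    in-𝒢 = record
      { k = ∣ S ∣ ; k≥1 = a+1≡2s⇒1≤s {s = ∣ S ∣} a+1≡2s ; order = n≡3s+1⇒2n+1≡6s+3 {s = ∣ S ∣} n≡3s+1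
      ; regular = reg
      ; x = x ; y = y ; z = z ; A = A ; B = B ; C = C ; S = S
      ; x≢y = x≢y
      ; x≢z = different-kinds (part-∈ kind kind-x) z∈Z λ ()
      ; y≢z = different-kinds (part-∈ kind kind-y) z∈Z λ ()
      ; x∉ = kind-∉ kind-x (λ ()) , kind-∉ kind-x (λ ()) , kind-∉ kind-x (λ ()) , x∉S
      ; y∉ = kind-∉ kind-y (λ ()) , kind-∉ kind-y (λ ()) , kind-∉ kind-y (λ ()) , y∉S
      ; z∉ = kind-∉ kind-z (λ ()) , kind-∉ kind-z (λ ()) , kind-∉ kind-z (λ ()) , ∉S free-z
      ; A∩B = λ _ v∈A → kind-∉ (∈-part kind v∈A) λ ()
      ; A∩C = λ _ v∈A → kind-∉ (∈-part kind v∈A) λ ()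
      ; A∩S = λ _ v∈A → ∉S (proj₁ (meaning v∈A))
      ; B∩C = λ _ v∈B → kind-∉ (∈-part kind v∈B) λ ()
      ; B∩S = λ _ v∈B → ∉S (proj₁ (meaning v∈B))
      ; C∩S = λ _ v∈C → ∉S (proj₁ (meaning v∈C))
      ; cover = cover
      ; |A| = a+1≡2s⇒a≡2s∸1 {s = ∣ S ∣} a+1≡2s
      ; |C| = a+1≡2s⇒a≡2s∸1 {s = ∣ S ∣} c+1≡2s
      ; |B| = b≡s+2
      ; |S| = refl
      ; regA = L-sat.A-regular
      ; regC = C-regular
      ; regzBS = zBS-regular
      ; A→B∪S = λ _ _ u∈A v∈B∪S → Sum.[ L-sat.A⟶B u∈A , L-sat.A⟶S u∈A ] (x∈p∪q⁻ B S v∈B∪S)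
      ; B∪S→C = λ _ _ u∈B∪S v∈C → Sum.[ (λ u∈B → B⟶C u∈B v∈C) , (λ u∈S → S⟶C u∈S v∈C) ] (x∈p∪q⁻ B S u∈B∪S)
      ; C→A = λ _ _ → C⟶A
      ; C→z = λ _ → C⟶z
      ; z→A = λ _ → z⟶A
      ; x→y = x⟶y
      ; x→z = x⟶z
      ; x→A∪S = λ _ v∈A∪S → Sum.[ x⟶A , x⟶S ] (x∈p∪q⁻ A S v∈A∪S)
      ; z→y = z⟶y
      ; C∪S→y = λ _ u∈C∪S → Sum.[ C⟶y , S⟶y ] (x∈p∪q⁻ C S u∈C∪S)
      ; y→A∪B = λ _ v∈A∪B → Sum.[ y⟶A , y⟶B ] (x∈p∪q⁻ A B v∈A∪B)
      ; B∪C→x = λ _ u∈B∪C → Sum.[ B⟶x , C⟶x ] (x∈p∪q⁻ B C u∈B∪C)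
      }
      where
      kind-z : kind z ≡ kZ
      kind-z = ∈-part kind z∈Z

lemma3p2 : (n : ℕ) (T : Tournament (2 * n + 1)) → Regular T →
  (S : Subset (2 * n + 1)) (x y : Fin (2 * n + 1)) →
  x ≢ y → x ∉ S → y ∉ S →
  ((n ≥ 3 → 3 * ∣ S ∣ ≤ n ∸ 1 →
      Path3 T S x y ⊎ Σ (Tournament (2 * n + 1)) (λ T' → InG T' × Iso T T'))
  × (n ≥ 5 → 2 * ∣ S ∣ ≤ n → ¬ Path3 T S x y → Path4 T S x y))
lemma3p2 n T reg S x y x≢y x∉S y∉S = part-i , part-ii
  where
  part-i : n ≥ 3 → 3 * ∣ S ∣ ≤ n ∸ 1 → Path3 T S x y ⊎ Σ (Tournament (2 * n + 1)) (λ T' → InG T' × Iso T T')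
  part-i 3≤n 3s≤n∸1 with path3? T S x y
  ... | yes path    = inj₁ path
  ... | no  no-path = inj₂ (T , NoPath3.Extremal.in-𝒢 {n} T reg S x y x≢y x∉S y∉S no-path 3s+1≤n 3≤n ,
                              ↔-id _ , λ _ _ → refl)
    where 3s+1≤n = Arithmetic.≤∸1⇒+1≤ 3s≤n∸1 (≤-trans (s≤s z≤n) 3≤n)
  part-ii : n ≥ 5 → 2 * ∣ S ∣ ≤ n → ¬ Path3 T S x y → Path4 T S x y
  part-ii 5≤n 2s≤n no-path =
    decidable-stable (path4? T S x y) (NoPath3.path4-exists {n} T reg S x y x≢y x∉S y∉S no-path 2s≤n 5≤n)
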